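{- Let $w\in\mathbb{YF}_\infty$ and $n\in\mathbb{N}_0$. Then $\displaystyle\sum_{v\in\mathbb{YF}_n}\mu_w(v)=1$.
   Context: Words are finite words over $\{1,2\}$; $\varepsilon$ is the empty word; $|x|$ is the digit sum of $x$. $\mathbb{YF}$ is the set of all finite words, $\mathbb{YF}_n=\{x:|x|=n\}$. A word $y$ covers $x$ if $y$ is obtained from $x$ by replacing the leftmost $1$ of $x$ by $2$, or by inserting a $1$ somewhere to the left of the leftmost $1$ of $x$ (anywhere if $x$ has no $1$). $d(x,y)$ is the number of sequences $y=y_0,\dots,y_r=x$, $r=|y|-|x|\ge0$, with $y_j$ covering $y_{j+1}$ for all $j$. $\mathbb{YF}_\infty$ is the set of left-infinite words $\dots\alpha_2\alpha_1$ over $\{1,2\}$; $w_m$ is the word of the rightmost $m$ letters of $w$. For $w\in\mathbb{YF}_\infty$, $v\in\mathbb{YF}$: $\mu_w(v)=\lim_{m\to\infty}\frac{d(\varepsilon,v)d(v,w_m)}{d(\varepsilon,w_m)}$ (the limit exists). -}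

module Defs where

open import Data.Nat using (ℕ; zero; suc; _+_; _*_; _∸_; _<ᵇ_; _≥_)
open import Data.Bool using (if_then_else_)
open import Data.List using (List; []; _∷_; map; _++_; concatMap; length; filter; foldr)
open import Data.Integer using (+_)
open import Data.Rational using (ℚ; 0ℚ; 1ℚ; _/_; _-_; ∣_∣; _<_)
import Data.Rational as ℚ
open import Data.Product using (∃; Σ)
open import Relation.Binary.PropositionalEquality using (_≡_)
open import Relation.Nullary using (Dec; yes; no)

data Digit : Set where
  one two : Digit

-- Finite words, written left to right (head of the list = leftmost letter).
Word : Set
Word = List Digit

ε : Word
ε = []

val : Digit → ℕ
val one = 1
val two = 2

∣_∣w : Word → ℕ
∣ [] ∣w = 0
∣ a ∷ x ∣w = val a + ∣ x ∣w

_≟D_ : (a b : Digit) → Dec (a ≡ b)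
one ≟D one = yes _≡_.refl
one ≟D two = no λ ()
two ≟D one = no λ ()
two ≟D two = yes _≡_.refl

_≟W_ : (x y : Word) → Dec (x ≡ y)
[] ≟W [] = yes _≡_.refl
[] ≟W (_ ∷ _) = no λ ()
(_ ∷ _) ≟W [] = no λ ()
(a ∷ x) ≟W (b ∷ y) with a ≟D b | x ≟W y
... | yes _≡_.refl | yes _≡_.refl = yes _≡_.refl
... | no a≢b | _ = no λ { _≡_.refl → a≢b _≡_.refl }
... | yes _ | no x≢y = no λ { _≡_.refl → x≢y _≡_.refl }

-- ups x = list of all words y covering x:
-- replace the leftmost 1 of x by 2, or insert a 1 somewhere to the left
-- of the leftmost 1 of x (anywhere if x has no 1).
ups : Word → List Word
ups [] = (one ∷ []) ∷ []
ups (one ∷ x) = (two ∷ x) ∷ (one ∷ one ∷ x) ∷ []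
ups (two ∷ x) = (one ∷ two ∷ x) ∷ map (two ∷_) (ups x)

chains : ℕ → Word → List Word
chains zero x = x ∷ []
chains (suc r) x = concatMap (chains r) (ups x)

count : Word → List Word → ℕ
count y [] = 0
count y (z ∷ zs) with y ≟W z
... | yes _ = suc (count y zs)
... | no _ = count y zs

-- d(x,y): number of chains y = y_0, …, y_r = x with r = |y| - |x| ≥ 0
-- (0 if |y| < |x|, where no such chain exists)
d : Word → Word → ℕ
d x y = if ∣ y ∣w <ᵇ ∣ x ∣w then 0 else count y (chains (∣ y ∣w ∸ ∣ x ∣w) x)

YF : ℕ → List Word
YF zero = [] ∷ []
YF (suc zero) = (one ∷ []) ∷ []
YF (suc (suc n)) = map (one ∷_) (YF (suc n)) ++ map (two ∷_) (YF n)

-- left-infinite words … α₂ α₁ , represented as w i = α_{i+1}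
YF∞ : Set
YF∞ = ℕ → Digit

-- w_m : the rightmost m letters α_m … α_1
trunc : YF∞ → ℕ → Word
trunc w zero = []
trunc w (suc m) = w m ∷ trunc w m

-- a / b in ℚ (with the harmless convention a / 0 = 0; d(ε,·) is never 0)
frac : ℕ → ℕ → ℚ
frac a zero = 0ℚ
frac a (suc b) = (+ a) / suc b

-- the m-th term of the sequence whose limit defines μ_w(v)
μseq : YF∞ → Word → ℕ → ℚ
μseq w v m = frac (d ε v * d v (trunc w m)) (d ε (trunc w m))

sumℚ : List ℚ → ℚ
sumℚ = foldr ℚ._+_ 0ℚ

_⟶_ : (ℕ → ℚ) → ℚ → Set
s ⟶ L = ∀ (e : ℚ) → 0ℚ < e → ∃ λ (M : ℕ) → ∀ (m : ℕ) → m ≥ M → ∣ s m - L ∣ < e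

-- For m ≥ n the prefix y = w_m has digit sum at least n, and every covering chain from ε up
-- to y passes through exactly one word of digit sum n. Cutting the chains there gives
-- Σ_{v ∈ YF_n} d(ε,v) d(v,y) = d(ε,y), and d(ε,y) ≠ 0 because every word is reachable from ε.
-- So the sums are exactly 1 from m = n on.

module Submission where

open import Defs
open import Data.Nat using (ℕ)
open import Data.List using (map)
open import Data.Rational using (1ℚ)

open import Data.Bool using (false)
import Data.Integer as ℤ
open import Data.Integer.Tactic.RingSolver using (solve-∀)
open import Data.List using (List; []; _∷_; [_]; _++_; concatMap)
open import Data.List.Effectful using (module MonadProperties)
open import Data.List.Membership.Propositional using (_∈_; lose)
open import Data.List.Membership.Propositional.Properties using (∈-concatMap⁺)
open import Data.List.Properties using (concatMap-cong; concatMap-pure; ∷-injectiveˡ; map-cong; map-cong-local)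
open import Data.List.Relation.Unary.All as All using (All; []; _∷_)
import Data.List.Relation.Unary.All.Properties as All
open import Data.List.Relation.Unary.Any using (here; there)
import Data.Nat as ℕ
open import Data.Nat using (zero; suc; _+_; _*_; _∸_; _≤_; _≥_; _<ᵇ_; NonZero; z≤n; s≤s)
open import Data.Nat.ListAction using (sum)
open import Data.Nat.Properties using (+-comm; +-suc; *-comm; +-identityʳ; *-distribʳ-+; m+[n∸m]≡n; ≤-trans; n≤1+n; +-commutativeSemigroup)
open import Data.Product using (_,_)
open import Algebra.Properties.CommutativeSemigroup +-commutativeSemigroup using (interchange)
import Data.Rational as ℚ
open import Data.Rational using (0ℚ; fromℚᵘ)
open import Data.Rational.Properties using (toℚᵘ-injective; toℚᵘ-fromℚᵘ; toℚᵘ-homo-+; fromℚᵘ-cong; 0/n≡0; +-inverseʳ)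
open import Data.Rational.Unnormalised as ℚᵘ using (mkℚᵘ; *≡*)
import Data.Rational.Unnormalised.Properties as ℚᵘ
open import Function using (_∘_)
open import Relation.Binary.PropositionalEquality hiding ([_])
open import Relation.Nullary using (yes; no; contradiction)

open ≡-Reasoning

sum-map-0 : ∀ {A : Set} (xs : List A) → sum (map (λ _ → 0) xs) ≡ 0
sum-map-0 [] = refl
sum-map-0 (_ ∷ xs) = sum-map-0 xs

sum-map-+ : ∀ {A : Set} (f g : A → ℕ) xs →
  sum (map (λ x → f x + g x) xs) ≡ sum (map f xs) + sum (map g xs)
sum-map-+ f g [] = refl
sum-map-+ f g (x ∷ xs) = begin
  f x + g x + sum (map (λ x → f x + g x) xs)    ≡⟨ cong (f x + g x +_) (sum-map-+ f g xs) ⟩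
  f x + g x + (sum (map f xs) + sum (map g xs)) ≡⟨ interchange (f x) (g x) _ _ ⟩
  f x + sum (map f xs) + (g x + sum (map g xs)) ∎

count-++ : ∀ y xs ys → count y (xs ++ ys) ≡ count y xs + count y ys
count-++ y [] ys = refl
count-++ y (z ∷ xs) ys with y ≟W z
... | yes _ = cong suc (count-++ y xs ys)
... | no _ = count-++ y xs ys

count-concatMap : ∀ y (f : Word → List Word) xs →
  count y (concatMap f xs) ≡ sum (map (count y ∘ f) xs)
count-concatMap y f [] = refl
count-concatMap y f (x ∷ xs) =
  trans (count-++ y (f x) (concatMap f xs)) (cong (count y (f x) +_) (count-concatMap y f xs))

count-∈ : ∀ {y xs} → y ∈ xs → NonZero (count y xs)
count-∈ {y} {z ∷ xs} y∈ with y ≟W z | y∈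
... | yes _ | _ = _
... | no y≢z | here y≡z = contradiction y≡z y≢z
... | no _ | there y∈xs = count-∈ y∈xs

count-map-∷ : ∀ a z ys → count (a ∷ z) (map (a ∷_) ys) ≡ count z ys
count-map-∷ a z [] = refl
-- The letter is split on so that (a ∷ z) ≟W (a ∷ v) computes to z ≟W v.
count-map-∷ one z (v ∷ ys) with z ≟W v
... | yes refl = cong suc (count-map-∷ one z ys)
... | no _ = count-map-∷ one z ys
count-map-∷ two z (v ∷ ys) with z ≟W v
... | yes refl = cong suc (count-map-∷ two z ys)
... | no _ = count-map-∷ two z ys

count-map-∷-≢ : ∀ {a b} z ys → a ≢ b → count (a ∷ z) (map (b ∷_) ys) ≡ 0
count-map-∷-≢ z [] a≢b = refl
count-map-∷-≢ {a} {b} z (v ∷ ys) a≢b with (a ∷ z) ≟W (b ∷ v)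
... | yes az≡bv = contradiction (∷-injectiveˡ az≡bv) a≢b
... | no _ = count-map-∷-≢ z ys a≢b

sum-count-singleton : ∀ z (g : Word → ℕ) ys →
  sum (map (λ v → count v [ z ] * g v) ys) ≡ count z ys * g z
sum-count-singleton z g [] = refl
sum-count-singleton z g (v ∷ ys) with v ≟W z | z ≟W v
... | yes refl | yes _ = cong₂ _+_ (+-identityʳ (g z)) (sum-count-singleton z g ys)
... | no _ | no _ = sum-count-singleton z g ys
... | yes refl | no z≢z = contradiction refl z≢z
... | no v≢z | yes refl = contradiction refl v≢z

sum-regroup : ∀ (g : Word → ℕ) ys xs → All (λ x → count x ys ≡ 1) xs →
  sum (map g xs) ≡ sum (map (λ v → count v xs * g v) ys)
sum-regroup g ys [] [] = sym (sum-map-0 ys)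
sum-regroup g ys (x ∷ xs) (x-once ∷ xs-once) = begin
  g x + sum (map g xs)
    ≡⟨ cong₂ _+_ g-x (sum-regroup g ys xs xs-once) ⟩
  sum (map (λ v → count v [ x ] * g v) ys) + sum (map (λ v → count v xs * g v) ys)
    ≡⟨ sum-map-+ (λ v → count v [ x ] * g v) (λ v → count v xs * g v) ys ⟨
  sum (map (λ v → count v [ x ] * g v + count v xs * g v) ys)
    ≡⟨ cong sum (map-cong (λ v → sym (*-distribʳ-+ (g v) (count v [ x ]) (count v xs))) ys) ⟩
  sum (map (λ v → (count v [ x ] + count v xs) * g v) ys)
    ≡⟨ cong sum (map-cong (λ v → cong (_* g v) (count-++ v [ x ] xs)) ys) ⟨
  sum (map (λ v → count v (x ∷ xs) * g v) ys) ∎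
  where
  g-x : g x ≡ sum (map (λ v → count v [ x ] * g v) ys)
  g-x = sym (trans (sum-count-singleton x g ys) (trans (cong (_* g x) x-once) (+-identityʳ (g x))))

YF-∣∣ : ∀ n → All (λ v → ∣ v ∣w ≡ n) (YF n)
YF-∣∣ zero = refl ∷ []
YF-∣∣ (suc zero) = refl ∷ []
YF-∣∣ (suc (suc n)) =
  All.++⁺ (All.map⁺ (All.map (cong suc) (YF-∣∣ (suc n)))) (All.map⁺ (All.map (cong (2 +_)) (YF-∣∣ n)))

count-YF : ∀ n z → ∣ z ∣w ≡ n → count z (YF n) ≡ 1
count-YF zero [] refl = refl
count-YF zero (one ∷ z) ()
count-YF zero (two ∷ z) ()
count-YF (suc n) [] ()
count-YF (suc zero) (one ∷ []) refl = refl
count-YF (suc zero) (one ∷ one ∷ z) ()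
count-YF (suc zero) (one ∷ two ∷ z) ()
count-YF (suc zero) (two ∷ z) ()
count-YF (suc (suc n)) (one ∷ z) ∣z∣≡ = begin
  count (one ∷ z) (map (one ∷_) (YF (suc n)) ++ map (two ∷_) (YF n))
    ≡⟨ count-++ (one ∷ z) (map (one ∷_) (YF (suc n))) (map (two ∷_) (YF n)) ⟩
  count (one ∷ z) (map (one ∷_) (YF (suc n))) + count (one ∷ z) (map (two ∷_) (YF n))
    ≡⟨ cong₂ _+_ (count-map-∷ one z (YF (suc n))) (count-map-∷-≢ z (YF n) λ ()) ⟩
  count z (YF (suc n)) + 0
    ≡⟨ cong (_+ 0) (count-YF (suc n) z (cong ℕ.pred ∣z∣≡)) ⟩
  1 ∎
count-YF (suc (suc n)) (two ∷ z) ∣z∣≡ = begin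
  count (two ∷ z) (map (one ∷_) (YF (suc n)) ++ map (two ∷_) (YF n))
    ≡⟨ count-++ (two ∷ z) (map (one ∷_) (YF (suc n))) (map (two ∷_) (YF n)) ⟩
  count (two ∷ z) (map (one ∷_) (YF (suc n))) + count (two ∷ z) (map (two ∷_) (YF n))
    ≡⟨ cong₂ _+_ (count-map-∷-≢ z (YF (suc n)) λ ()) (count-map-∷ two z (YF n)) ⟩
  count z (YF n)
    ≡⟨ count-YF n z (cong (ℕ.pred ∘ ℕ.pred) ∣z∣≡) ⟩
  1 ∎

chains-+ : ∀ a b x → chains (a + b) x ≡ concatMap (chains b) (chains a x)
chains-+ zero b x = sym (MonadProperties.left-identity x (chains b))
chains-+ (suc a) b x = begin
  concatMap (chains (a + b)) (ups x)
    ≡⟨ concatMap-cong (chains-+ a b) (ups x) ⟩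
  concatMap (concatMap (chains b) ∘ chains a) (ups x)
    ≡⟨ MonadProperties.associative (ups x) (chains a) (chains b) ⟩
  concatMap (chains b) (concatMap (chains a) (ups x)) ∎

chains-suc : ∀ r x → chains (suc r) x ≡ concatMap ups (chains r x)
chains-suc r x = begin
  chains (suc r) x                      ≡⟨ cong (λ k → chains k x) (+-comm 1 r) ⟩
  chains (r + 1) x                      ≡⟨ chains-+ r 1 x ⟩
  concatMap (chains 1) (chains r x)     ≡⟨ concatMap-cong (concatMap-pure ∘ ups) (chains r x) ⟩
  concatMap ups (chains r x)            ∎

ups-∣∣ : ∀ x → All (λ y → ∣ y ∣w ≡ suc ∣ x ∣w) (ups x)
ups-∣∣ [] = refl ∷ []
ups-∣∣ (one ∷ x) = refl ∷ refl ∷ []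
ups-∣∣ (two ∷ x) = refl ∷ All.map⁺ (All.map (cong (2 +_)) (ups-∣∣ x))

chains-∣∣ : ∀ r x → All (λ z → ∣ z ∣w ≡ r + ∣ x ∣w) (chains r x)
chains-∣∣ zero x = refl ∷ []
chains-∣∣ (suc r) x = All.concat⁺ (All.map⁺ (All.map chains-from-up (ups-∣∣ x)))
  where
  chains-from-up : ∀ {u} → ∣ u ∣w ≡ suc ∣ x ∣w → All (λ z → ∣ z ∣w ≡ suc r + ∣ x ∣w) (chains r u)
  chains-from-up {u} ∣u∣≡ =
    All.map (λ ∣z∣≡ → trans ∣z∣≡ (trans (cong (r +_) ∣u∣≡) (+-suc r ∣ x ∣w))) (chains-∣∣ r u)

one∷x∈ups : ∀ x → one ∷ x ∈ ups x
one∷x∈ups [] = here refl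
one∷x∈ups (one ∷ x) = there (here refl)
one∷x∈ups (two ∷ x) = here refl

∈-chains-suc : ∀ r x {u y} → u ∈ chains r x → y ∈ ups u → y ∈ chains (suc r) x
∈-chains-suc r x u∈ y∈ = subst (_ ∈_) (sym (chains-suc r x)) (∈-concatMap⁺ ups (lose u∈ y∈))

ε-reaches : ∀ y → y ∈ chains ∣ y ∣w ε
ε-reaches [] = here refl
ε-reaches (one ∷ x) = ∈-chains-suc ∣ x ∣w ε (ε-reaches x) (one∷x∈ups x)
ε-reaches (two ∷ x) =
  ∈-chains-suc (suc ∣ x ∣w) ε (∈-chains-suc ∣ x ∣w ε (ε-reaches x) (one∷x∈ups x)) (here refl)

≤⇒≮ᵇ : ∀ {m n} → m ≤ n → (n <ᵇ m) ≡ false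
≤⇒≮ᵇ z≤n = refl
≤⇒≮ᵇ (s≤s m≤n) = ≤⇒≮ᵇ m≤n

d-≤ : ∀ v y → ∣ v ∣w ≤ ∣ y ∣w → d v y ≡ count y (chains (∣ y ∣w ∸ ∣ v ∣w) v)
d-≤ v y ∣v∣≤∣y∣ rewrite ≤⇒≮ᵇ ∣v∣≤∣y∣ = refl

d-ε-nonZero : ∀ y → NonZero (d ε y)
d-ε-nonZero y = count-∈ (ε-reaches y)

d-ε-through-level : ∀ n y → n ≤ ∣ y ∣w → sum (map (λ v → d ε v * d v y) (YF n)) ≡ d ε y
d-ε-through-level n y n≤∣y∣ = begin
  sum (map (λ v → d ε v * d v y) (YF n))
    ≡⟨ cong sum (map-cong-local (All.map factors (YF-∣∣ n))) ⟩
  sum (map (λ v → count v (chains n ε) * count y (chains k v)) (YF n))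
    ≡⟨ sum-regroup (λ z → count y (chains k z)) (YF n) (chains n ε) level-n-once ⟨
  sum (map (λ z → count y (chains k z)) (chains n ε))
    ≡⟨ count-concatMap y (chains k) (chains n ε) ⟨
  count y (concatMap (chains k) (chains n ε))
    ≡⟨ cong (count y) (chains-+ n k ε) ⟨
  count y (chains (n + k) ε)
    ≡⟨ cong (λ r → count y (chains r ε)) (m+[n∸m]≡n n≤∣y∣) ⟩
  d ε y ∎
  where
  k = ∣ y ∣w ∸ n
  factors : ∀ {v} → ∣ v ∣w ≡ n → d ε v * d v y ≡ count v (chains n ε) * count y (chains k v)
  factors {v} refl = cong (d ε v *_) (d-≤ v y n≤∣y∣)
  level-n-once : All (λ z → count z (YF n) ≡ 1) (chains n ε)
  level-n-once = All.map (λ ∣z∣≡ → count-YF n _ (trans ∣z∣≡ (+-identityʳ n))) (chains-∣∣ n ε)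

fromℚᵘ-homo-+ : ∀ p q → fromℚᵘ (p ℚᵘ.+ q) ≡ fromℚᵘ p ℚ.+ fromℚᵘ q
fromℚᵘ-homo-+ p q = toℚᵘ-injective (ℚᵘ.≃-trans (toℚᵘ-fromℚᵘ (p ℚᵘ.+ q)) (ℚᵘ.≃-sym
  (ℚᵘ.≃-trans (toℚᵘ-homo-+ (fromℚᵘ p) (fromℚᵘ q)) (ℚᵘ.+-cong (toℚᵘ-fromℚᵘ p) (toℚᵘ-fromℚᵘ q)))))

frac-+ : ∀ a c D → frac a D ℚ.+ frac c D ≡ frac (a + c) D
frac-+ a c zero = refl
frac-+ a c (suc b) = begin
  fromℚᵘ p ℚ.+ fromℚᵘ q
    ≡⟨ fromℚᵘ-homo-+ p q ⟨
  fromℚᵘ (p ℚᵘ.+ q)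
    ≡⟨ fromℚᵘ-cong {p ℚᵘ.+ q} {mkℚᵘ (ℤ.+ (a + c)) b} (*≡* (common-denominator (ℤ.+ a) (ℤ.+ c) (ℤ.+ suc b))) ⟩
  fromℚᵘ (mkℚᵘ (ℤ.+ (a + c)) b) ∎
  where
  common-denominator : ∀ a c s → (a ℤ.* s ℤ.+ c ℤ.* s) ℤ.* s ≡ (a ℤ.+ c) ℤ.* (s ℤ.* s)
  common-denominator = solve-∀
  p = mkℚᵘ (ℤ.+ a) b
  q = mkℚᵘ (ℤ.+ c) b

frac-0 : ∀ D → frac 0 D ≡ 0ℚ
frac-0 zero = refl
frac-0 (suc b) = 0/n≡0 (suc b)

frac-self : ∀ n → .{{NonZero n}} → frac n n ≡ 1ℚ
frac-self (suc b) = fromℚᵘ-cong {mkℚᵘ (ℤ.+ suc b) b} {ℚᵘ.1ℚᵘ} (*≡* (cong ℤ.+_ (*-comm (suc b) 1)))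

sumℚ-map-frac : ∀ {A : Set} (f : A → ℕ) D xs →
  sumℚ (map (λ x → frac (f x) D) xs) ≡ frac (sum (map f xs)) D
sumℚ-map-frac f D [] = sym (frac-0 D)
sumℚ-map-frac f D (x ∷ xs) =
  trans (cong (frac (f x) D ℚ.+_) (sumℚ-map-frac f D xs)) (frac-+ (f x) (sum (map f xs)) D)

eventually-≡⇒⟶ : ∀ {s L} M → (∀ m → m ≥ M → s m ≡ L) → s ⟶ L
eventually-≡⇒⟶ {L = L} M s≡L e 0<e = M , λ m m≥M →
  subst (λ q → ℚ.∣ q ℚ.- L ∣ ℚ.< e) (sym (s≡L m m≥M))
    (subst (λ q → ℚ.∣ q ∣ ℚ.< e) (sym (+-inverseʳ L)) 0<e)

trunc-∣∣ : ∀ w m → m ≤ ∣ trunc w m ∣w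
trunc-∣∣ w zero = z≤n
trunc-∣∣ w (suc m) with w m
... | one = s≤s (trunc-∣∣ w m)
... | two = s≤s (≤-trans (trunc-∣∣ w m) (n≤1+n _))

mainTheorem6 : (w : YF∞) (n : ℕ) →
    (λ m → sumℚ (map (λ v → μseq w v m) (YF n))) ⟶ 1ℚ
mainTheorem6 w n = eventually-≡⇒⟶ n λ m m≥n → let y = trunc w m in begin
  sumℚ (map (λ v → μseq w v m) (YF n))
    ≡⟨ sumℚ-map-frac (λ v → d ε v * d v y) (d ε y) (YF n) ⟩
  frac (sum (map (λ v → d ε v * d v y) (YF n))) (d ε y)
    ≡⟨ cong (λ a → frac a (d ε y)) (d-ε-through-level n y (≤-trans m≥n (trunc-∣∣ w m))) ⟩
  frac (d ε y) (d ε y)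
    ≡⟨ frac-self (d ε y) {{d-ε-nonZero y}} ⟩
  1ℚ ∎
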